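{- Let $m\ge 1$ and $n\geq 1$ be integers with $2n\leq m$. Then $pc(2n,m)=pc(2n+1,m)=2^n$.
   Context: A composition of a positive integer $n$ of length $k$ is a sequence $\sigma=(\sigma_1,\ldots,\sigma_k)$ of positive integers with $\sum_i \sigma_i=n$. For an integer $m\geq 1$, $\sigma$ is palindromic modulo $m$ if $\sigma_i\equiv\sigma_{k-i+1}\pmod m$ for all $1\le i\le k$. $pc(n,m)$ denotes the number of compositions of $n$ that are palindromic modulo $m$. -}

module Defs where

open import Data.Nat using (ℕ; zero; suc; _+_; _∸_; NonZero)
open import Data.Nat.DivMod using (_%_)
open import Data.List using (List; []; _∷_; map; concatMap; length; filter; reverse; zip; sum; upTo)
open import Data.List.Relation.Unary.All using (All; all?)
open import Data.Product using (_×_; _,_; uncurry)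
open import Relation.Binary.PropositionalEquality using (_≡_)
open import Relation.Nullary using (Dec)
open import Data.Nat.Properties using (_≟_)

-- All compositions of n (lists of positive integers summing to n),
-- enumerated by choosing the first part k ∈ {1,…,n}.
-- The fuel argument f (≥ n) only serves to make recursion structural.
compositionsF : ℕ → ℕ → List (List ℕ)
compositionsF f       zero    = [] ∷ []
compositionsF zero    (suc n) = []
compositionsF (suc f) (suc n) =
  concatMap (λ j → map (suc j ∷_) (compositionsF f (n ∸ j))) (upTo (suc n))

compositions : ℕ → List (List ℕ)
compositions n = compositionsF n n

_≡[mod_]_ : ℕ → (m : ℕ) → .{{NonZero m}} → ℕ → Set
a ≡[mod m ] b = a % m ≡ b % m

PalindromicMod : (m : ℕ) → .{{NonZero m}} → List ℕ → Set
PalindromicMod m σ = All (λ p → (Data.Product.proj₁ p) ≡[mod m ] (Data.Product.proj₂ p)) (zip σ (reverse σ))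

palindromicMod? : (m : ℕ) → .{{_ : NonZero m}} → (σ : List ℕ) → Dec (PalindromicMod m σ)
palindromicMod? m σ = all? (λ p → (Data.Product.proj₁ p % m) ≟ (Data.Product.proj₂ p % m)) (zip σ (reverse σ))

pc : ℕ → (m : ℕ) → .{{NonZero m}} → ℕ
pc n m = length (filter (palindromicMod? m) (compositions n))

-- A composition of n + 1 is encoded by a bit string of length n, one bit per gap between
-- consecutive units saying whether a part ends there; reversing the composition reverses
-- the bit string, so palindromic compositions of n + 1 correspond to palindromic bit
-- strings of length n, of which there are 2 ^ ⌈ n /2⌉. If n + 1 ≤ m + 1 and there are at
-- least two parts, every part lies in [1, m], where congruence modulo m is equality, so
-- palindromic modulo m means palindromic.
module Submission where

open import Defs
open import Data.Bool using (Bool; true; false)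
import Data.Bool as Bool
open import Data.List using (List; []; _∷_; _++_; _∷ʳ_; [_]; map; concatMap; length; filter; reverse; zip; upTo; applyUpTo)
open import Data.Nat.ListAction using (sum)
open import Data.List.Properties using (≡-dec; map-++; map-∘; map-applyUpTo; concatMap-cong; concatMap-map; map-concatMap; length-++; length-reverse; unfold-reverse; reverse-++; filter-++; filter-none; ∷-injective; ∷ʳ-injective)
open import Data.List.Relation.Unary.All using (All; []; _∷_; universal)
import Data.List.Relation.Unary.All as All
open import Data.List.Relation.Unary.All.Properties using (++⁺; map⁺; zipWith⁺)
open import Data.List.Relation.Binary.Permutation.Propositional using (↭-sym)
open import Data.List.Relation.Binary.Permutation.Propositional.Properties using (All-resp-↭; ↭-reverse)
import Data.List.Relation.Binary.Pointwise as Pointwise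
open import Data.Nat using (ℕ; zero; suc; _+_; _*_; _^_; _∸_; _≤_; _<_; s≤s; z<s; NonZero; ⌊_/2⌋; ⌈_/2⌉)
open import Data.Nat.Properties using (+-commutativeSemigroup; +-comm; +-identityʳ; ≤-refl; ≤-trans; <-≤-trans; ≤-pred; m≤m+n; m≤n+m; m<m+n; m<n+m; m∸n≤m; m≤n⇒m<n∨m≡n; n≤1+n; <⇒≢; suc-injective; n≡⌊n+n/2⌋; n≡⌈n+n/2⌉)
open import Algebra.Properties.CommutativeSemigroup +-commutativeSemigroup using (interchange)
open import Data.Nat.DivMod using (_%_; m<n⇒m%n≡m; n%n≡0)
open import Data.Product using (_×_; _,_; proj₁; proj₂; map₁)
open import Data.Sum using (inj₁; inj₂)
open import Function using (_∘_; id; _⇔_; mk⇔; Equivalence)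
open import Relation.Binary.PropositionalEquality using (_≡_; _≢_; refl; sym; trans; cong; cong₂; subst; module ≡-Reasoning)
open import Relation.Nullary using (yes; no; ¬_; contradiction)
open import Level using (Level)
open import Relation.Unary using (Pred; Decidable)

private
  variable
    A : Set
    a c : A
    xs ys : List A
    n f g x y : ℕ
    p q : Level

count : {P : Pred A p} → Decidable P → List A → ℕ
count P? xs = length (filter P? xs)

module _ {P : Pred A p} (P? : Decidable P) where

  count-++ : ∀ xs ys → count P? (xs ++ ys) ≡ count P? xs + count P? ys
  count-++ xs ys = trans (cong length (filter-++ P? xs ys)) (length-++ (filter P? xs))

  count-map : {B : Set} (h : B → A) (zs : List B) → count P? (map h zs) ≡ count (P? ∘ h) zs
  count-map h [] = refl
  count-map h (z ∷ zs) with P? (h z)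
  ... | yes _ = cong suc (count-map h zs)
  ... | no _ = count-map h zs

  count-none : (∀ x → ¬ P x) → ∀ xs → count P? xs ≡ 0
  count-none ¬P xs = cong length (filter-none P? (universal ¬P xs))

  count-cong : {Q : Pred A q} (Q? : Decidable Q) → All (λ x → P x ⇔ Q x) xs → count P? xs ≡ count Q? xs
  count-cong Q? [] = refl
  count-cong {xs = x ∷ xs} Q? (P⇔Q ∷ rest) with P? x | Q? x
  ... | yes _ | yes _ = cong suc (count-cong Q? rest)
  ... | no _ | no _ = count-cong Q? rest
  ... | yes p | no ¬q = contradiction (Equivalence.to P⇔Q p) ¬q
  ... | no ¬p | yes q = contradiction (Equivalence.from P⇔Q q) ¬p

Palindrome : List A → Set
Palindrome xs = xs ≡ reverse xs

reverse-∷-∷ʳ : ∀ (a : A) xs c → reverse (a ∷ (xs ∷ʳ c)) ≡ c ∷ (reverse xs ∷ʳ a)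
reverse-∷-∷ʳ a xs c = trans (unfold-reverse a (xs ∷ʳ c)) (cong (_∷ʳ a) (reverse-++ xs [ c ]))

palindrome-∷-∷ʳ⁻ : Palindrome (a ∷ (xs ∷ʳ c)) → a ≡ c × Palindrome xs
palindrome-∷-∷ʳ⁻ {a = a} {xs} {c} pal with ∷-injective (trans pal (reverse-∷-∷ʳ a xs c))
... | a≡c , xs∷ʳc≡rev = a≡c , proj₁ (∷ʳ-injective xs (reverse xs) xs∷ʳc≡rev)

palindrome-∷-∷ʳ⁺ : Palindrome xs → Palindrome (a ∷ (xs ∷ʳ a))
palindrome-∷-∷ʳ⁺ {xs = xs} {a} pal = trans (cong (λ ys → a ∷ (ys ∷ʳ a)) pal) (sym (reverse-∷-∷ʳ a xs a))

bitStrings : ℕ → List (List Bool)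
bitStrings zero = [ [] ]
bitStrings (suc n) = map (true ∷_) (bitStrings n) ++ map (false ∷_) (bitStrings n)

bitStrings-length : ∀ n → All (λ b → length b ≡ n) (bitStrings n)
bitStrings-length zero = refl ∷ []
bitStrings-length (suc n) = ++⁺ (map⁺ lengths) (map⁺ lengths)
  where
  lengths : All (λ b → suc (length b) ≡ suc n) (bitStrings n)
  lengths = All.map (cong suc) (bitStrings-length n)

count-bitStrings-∷ : {P : Pred (List Bool) p} (P? : Decidable P) → ∀ n →
  count P? (bitStrings (suc n)) ≡ count (P? ∘ (true ∷_)) (bitStrings n) + count (P? ∘ (false ∷_)) (bitStrings n)
count-bitStrings-∷ P? n = trans (count-++ P? (map (true ∷_) (bitStrings n)) _)
  (cong₂ _+_ (count-map P? (true ∷_) (bitStrings n)) (count-map P? (false ∷_) (bitStrings n)))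

count-bitStrings-∷ʳ : {P : Pred (List Bool) p} (P? : Decidable P) → ∀ n →
  count P? (bitStrings (suc n)) ≡ count (P? ∘ (_∷ʳ true)) (bitStrings n) + count (P? ∘ (_∷ʳ false)) (bitStrings n)
count-bitStrings-∷ʳ P? zero = trans (count-bitStrings-∷ P? zero)
  (cong₂ _+_ (count-cong (P? ∘ (true ∷_)) (P? ∘ (_∷ʳ true)) (mk⇔ id id ∷ []))
              (count-cong (P? ∘ (false ∷_)) (P? ∘ (_∷ʳ false)) (mk⇔ id id ∷ [])))
count-bitStrings-∷ʳ P? (suc n) = begin
  count P? (bitStrings (2 + n))
    ≡⟨ count-bitStrings-∷ P? (suc n) ⟩
  count (P? ∘ (true ∷_)) (bitStrings (suc n)) + count (P? ∘ (false ∷_)) (bitStrings (suc n))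
    ≡⟨ cong₂ _+_ (count-bitStrings-∷ʳ _ n) (count-bitStrings-∷ʳ _ n) ⟩
  (tt + tf) + (ft + ff)
    ≡⟨ interchange tt tf ft ff ⟩
  (tt + ft) + (tf + ff)
    ≡⟨ sym (cong₂ _+_ (count-bitStrings-∷ _ n) (count-bitStrings-∷ _ n)) ⟩
  count (P? ∘ (_∷ʳ true)) (bitStrings (suc n)) + count (P? ∘ (_∷ʳ false)) (bitStrings (suc n)) ∎
  where
  open ≡-Reasoning
  tt = count (λ b → P? (true ∷ (b ∷ʳ true))) (bitStrings n)
  tf = count (λ b → P? (true ∷ (b ∷ʳ false))) (bitStrings n)
  ft = count (λ b → P? (false ∷ (b ∷ʳ true))) (bitStrings n)
  ff = count (λ b → P? (false ∷ (b ∷ʳ false))) (bitStrings n)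

palindrome? : Decidable (Palindrome {A = Bool})
palindrome? b = ≡-dec Bool._≟_ b (reverse b)

count-palindromes : ∀ n → count palindrome? (bitStrings n) ≡ 2 ^ ⌈ n /2⌉
count-palindromes zero = refl
count-palindromes (suc zero) = refl
count-palindromes (suc (suc n)) = begin
  count palindrome? (bitStrings (2 + n))
    ≡⟨ count-bitStrings-∷ palindrome? (suc n) ⟩
  count (palindrome? ∘ (true ∷_)) (bitStrings (suc n)) + count (palindrome? ∘ (false ∷_)) (bitStrings (suc n))
    ≡⟨ cong₂ _+_ (count-bitStrings-∷ʳ _ n) (count-bitStrings-∷ʳ _ n) ⟩
  (framed true true + framed true false) + (framed false true + framed false false)
    ≡⟨ cong₂ _+_ (cong₂ _+_ (matching true) (mismatching λ ())) (cong₂ _+_ (mismatching λ ()) (matching false)) ⟩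
  (C + 0) + C
    ≡⟨ +-comm (C + 0) C ⟩
  2 * C
    ≡⟨ cong (2 *_) (count-palindromes n) ⟩
  2 ^ ⌈ 2 + n /2⌉ ∎
  where
  open ≡-Reasoning
  C = count palindrome? (bitStrings n)
  framed? : ∀ a c → Decidable (λ b → Palindrome (a ∷ (b ∷ʳ c)))
  framed? a c b = palindrome? (a ∷ (b ∷ʳ c))
  framed : Bool → Bool → ℕ
  framed a c = count (framed? a c) (bitStrings n)
  matching : ∀ a → framed a a ≡ C
  matching a = count-cong (framed? a a) palindrome?
    (universal (λ _ → mk⇔ (proj₂ ∘ palindrome-∷-∷ʳ⁻) palindrome-∷-∷ʳ⁺) (bitStrings n))
  mismatching : ∀ {a c} → a ≢ c → framed a c ≡ 0
  mismatching {a} {c} a≢c =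
    count-none (framed? a c) (λ _ → a≢c ∘ proj₁ ∘ palindrome-∷-∷ʳ⁻) (bitStrings n)

compositionsF-fuel : n ≤ f → n ≤ g → compositionsF f n ≡ compositionsF g n
compositionsF-fuel {zero} _ _ = refl
compositionsF-fuel {suc n} (s≤s n≤f) (s≤s n≤g) = concatMap-cong
  (λ j → cong (map (suc j ∷_)) (compositionsF-fuel (≤-trans (m∸n≤m n j) n≤f) (≤-trans (m∸n≤m n j) n≤g)))
  (upTo (suc n))

compositions-suc : ∀ n →
  compositions (suc n) ≡ concatMap (λ j → map (suc j ∷_) (compositions (n ∸ j))) (upTo (suc n))
compositions-suc n = concatMap-cong
  (λ j → cong (map (suc j ∷_)) (compositionsF-fuel (m∸n≤m n j) ≤-refl))
  (upTo (suc n))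

sucHead : List ℕ → List ℕ
sucHead [] = []
sucHead (x ∷ xs) = suc x ∷ xs

sucLast : List ℕ → List ℕ
sucLast [] = []
sucLast (x ∷ []) = suc x ∷ []
sucLast (x ∷ y ∷ xs) = x ∷ sucLast (y ∷ xs)

sucHead-sucLast : ∀ xs → sucHead (sucLast xs) ≡ sucLast (sucHead xs)
sucHead-sucLast [] = refl
sucHead-sucLast (x ∷ []) = refl
sucHead-sucLast (x ∷ y ∷ xs) = refl

compositions-suc-suc : ∀ n →
  compositions (2 + n) ≡ map (1 ∷_) (compositions (suc n)) ++ map sucHead (compositions (suc n))
compositions-suc-suc n = begin
  compositions (2 + n)
    ≡⟨ compositions-suc (suc n) ⟩
  F 0 ++ concatMap F (applyUpTo suc (suc n))
    ≡⟨ cong (λ js → F 0 ++ concatMap F js) (sym (map-applyUpTo id suc (suc n))) ⟩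
  F 0 ++ concatMap F (map suc (upTo (suc n)))
    ≡⟨ cong (F 0 ++_) (concatMap-map F suc (upTo (suc n))) ⟩
  F 0 ++ concatMap (λ j → map (suc (suc j) ∷_) (compositions (n ∸ j))) (upTo (suc n))
    ≡⟨ cong (F 0 ++_) (concatMap-cong (λ j → map-∘ (compositions (n ∸ j))) (upTo (suc n))) ⟩
  F 0 ++ concatMap (map sucHead ∘ G) (upTo (suc n))
    ≡⟨ cong (F 0 ++_) (sym (map-concatMap sucHead G (upTo (suc n)))) ⟩
  F 0 ++ map sucHead (concatMap G (upTo (suc n)))
    ≡⟨ cong (λ cs → F 0 ++ map sucHead cs) (sym (compositions-suc n)) ⟩
  map (1 ∷_) (compositions (suc n)) ++ map sucHead (compositions (suc n)) ∎
  where
  open ≡-Reasoning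
  F G : ℕ → List (List ℕ)
  F j = map (suc j ∷_) (compositions (suc n ∸ j))
  G j = map (suc j ∷_) (compositions (n ∸ j))

-- Bit i of b says whether a part ends right after the (i+1)-st unit. The pair (k , cs)
-- stands for suc k ∷ cs, so that the head of toComposition b is syntactically a
-- successor and 1 ∷_, sucHead commute with toComposition by computation.
toComposition : List Bool → List ℕ
firstPart∸1,rest : List Bool → ℕ × List ℕ

toComposition b = suc (proj₁ (firstPart∸1,rest b)) ∷ proj₂ (firstPart∸1,rest b)

firstPart∸1,rest [] = 0 , []
firstPart∸1,rest (true ∷ b) = 0 , toComposition b
firstPart∸1,rest (false ∷ b) = map₁ suc (firstPart∸1,rest b)

compositions≡map-toComposition : ∀ n → compositions (suc n) ≡ map toComposition (bitStrings n)
compositions≡map-toComposition zero = refl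
compositions≡map-toComposition (suc n) = begin
  compositions (2 + n)
    ≡⟨ compositions-suc-suc n ⟩
  map (1 ∷_) (compositions (suc n)) ++ map sucHead (compositions (suc n))
    ≡⟨ cong (λ cs → map (1 ∷_) cs ++ map sucHead cs) (compositions≡map-toComposition n) ⟩
  map (1 ∷_) (map toComposition bs) ++ map sucHead (map toComposition bs)
    ≡⟨ cong₂ _++_ (sym (map-∘ bs)) (sym (map-∘ bs)) ⟩
  map (toComposition ∘ (true ∷_)) bs ++ map (toComposition ∘ (false ∷_)) bs
    ≡⟨ cong₂ _++_ (map-∘ bs) (map-∘ bs) ⟩
  map toComposition (map (true ∷_) bs) ++ map toComposition (map (false ∷_) bs)
    ≡⟨ sym (map-++ toComposition (map (true ∷_) bs) _) ⟩
  map toComposition (bitStrings (suc n)) ∎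
  where
  open ≡-Reasoning
  bs = bitStrings n

toComposition-positive : ∀ b → All (0 <_) (toComposition b)
rest-positive : ∀ b → All (0 <_) (proj₂ (firstPart∸1,rest b))

toComposition-positive b = z<s ∷ rest-positive b

rest-positive [] = []
rest-positive (true ∷ b) = toComposition-positive b
rest-positive (false ∷ b) = rest-positive b

sum-toComposition : ∀ b → sum (toComposition b) ≡ suc (length b)
sum-toComposition [] = refl
sum-toComposition (true ∷ b) = cong suc (sum-toComposition b)
sum-toComposition (false ∷ b) = cong suc (sum-toComposition b)

toComposition-injective : ∀ b b′ → length b ≡ length b′ → toComposition b ≡ toComposition b′ → b ≡ b′
toComposition-injective [] [] _ _ = refl
toComposition-injective (true ∷ b) (true ∷ b′) len eq =
  cong (true ∷_) (toComposition-injective b b′ (suc-injective len) (proj₂ (∷-injective eq)))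
toComposition-injective (false ∷ b) (false ∷ b′) len eq with ∷-injective eq
... | head≡ , rest≡ = cong (false ∷_)
  (toComposition-injective b b′ (suc-injective len) (cong₂ _∷_ (suc-injective head≡) rest≡))
toComposition-injective (true ∷ b) (false ∷ b′) _ ()
toComposition-injective (false ∷ b) (true ∷ b′) _ ()

toComposition-∷ʳ-true : ∀ b → toComposition (b ∷ʳ true) ≡ toComposition b ∷ʳ 1
toComposition-∷ʳ-true [] = refl
toComposition-∷ʳ-true (true ∷ b) = cong (1 ∷_) (toComposition-∷ʳ-true b)
toComposition-∷ʳ-true (false ∷ b) = cong sucHead (toComposition-∷ʳ-true b)

toComposition-∷ʳ-false : ∀ b → toComposition (b ∷ʳ false) ≡ sucLast (toComposition b)
toComposition-∷ʳ-false [] = refl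
toComposition-∷ʳ-false (true ∷ b) = cong (1 ∷_) (toComposition-∷ʳ-false b)
toComposition-∷ʳ-false (false ∷ b) =
  trans (cong sucHead (toComposition-∷ʳ-false b)) (sucHead-sucLast (toComposition b))

sucLast-∷ʳ : ∀ xs x → sucLast (xs ∷ʳ x) ≡ xs ∷ʳ suc x
sucLast-∷ʳ [] x = refl
sucLast-∷ʳ (y ∷ []) x = refl
sucLast-∷ʳ (y ∷ z ∷ xs) x = cong (y ∷_) (sucLast-∷ʳ (z ∷ xs) x)

sucLast-reverse : ∀ xs → sucLast (reverse xs) ≡ reverse (sucHead xs)
sucLast-reverse [] = refl
sucLast-reverse (x ∷ xs) = begin
  sucLast (reverse (x ∷ xs))   ≡⟨ cong sucLast (unfold-reverse x xs) ⟩
  sucLast (reverse xs ∷ʳ x)    ≡⟨ sucLast-∷ʳ (reverse xs) x ⟩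
  reverse xs ∷ʳ suc x          ≡⟨ unfold-reverse (suc x) xs ⟨
  reverse (suc x ∷ xs)         ∎
  where open ≡-Reasoning

toComposition-reverse : ∀ b → toComposition (reverse b) ≡ reverse (toComposition b)
toComposition-reverse [] = refl
toComposition-reverse (true ∷ b) = begin
  toComposition (reverse (true ∷ b))     ≡⟨ cong toComposition (unfold-reverse true b) ⟩
  toComposition (reverse b ∷ʳ true)      ≡⟨ toComposition-∷ʳ-true (reverse b) ⟩
  toComposition (reverse b) ∷ʳ 1         ≡⟨ cong (_∷ʳ 1) (toComposition-reverse b) ⟩
  reverse (toComposition b) ∷ʳ 1         ≡⟨ unfold-reverse 1 (toComposition b) ⟨
  reverse (toComposition (true ∷ b))     ∎
  where open ≡-Reasoning
toComposition-reverse (false ∷ b) = begin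
  toComposition (reverse (false ∷ b))    ≡⟨ cong toComposition (unfold-reverse false b) ⟩
  toComposition (reverse b ∷ʳ false)     ≡⟨ toComposition-∷ʳ-false (reverse b) ⟩
  sucLast (toComposition (reverse b))    ≡⟨ cong sucLast (toComposition-reverse b) ⟩
  sucLast (reverse (toComposition b))    ≡⟨ sucLast-reverse (toComposition b) ⟩
  reverse (toComposition (false ∷ b))    ∎
  where open ≡-Reasoning

palindrome⇔toComposition-palindrome : ∀ b → Palindrome b ⇔ Palindrome (toComposition b)
palindrome⇔toComposition-palindrome b = mk⇔
  (λ pal → trans (cong toComposition pal) (toComposition-reverse b))
  (λ pal → toComposition-injective b (reverse b) (sym (length-reverse b))
             (trans pal (sym (toComposition-reverse b))))

All-≤-sum : ∀ xs → All (_≤ sum xs) xs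
All-≤-sum [] = []
All-≤-sum (x ∷ xs) =
  m≤m+n x (sum xs) ∷ All.map (λ y≤ → ≤-trans y≤ (m≤n+m (sum xs) x)) (All-≤-sum xs)

All-<-sum : ∀ {x y} zs → All (0 <_) (x ∷ y ∷ zs) → All (_< sum (x ∷ y ∷ zs)) (x ∷ y ∷ zs)
All-<-sum {x} {y} zs (0<x ∷ 0<y ∷ _) =
  m<m+n x (<-≤-trans 0<y (m≤m+n y (sum zs)))
  ∷ All.map (λ z≤ → <-≤-trans (s≤s z≤) (m<n+m (sum (y ∷ zs)) 0<x)) (All-≤-sum (y ∷ zs))

module _ (m : ℕ) .{{_ : NonZero m}} where

  InRange : ℕ → Set
  InRange x = 0 < x × x ≤ m

  %≢0 : 0 < x → x < m → x % m ≢ 0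
  %≢0 0<x x<m x%m≡0 = <⇒≢ 0<x (sym (trans (sym (m<n⇒m%n≡m x<m)) x%m≡0))

  %-injective : InRange x → InRange y → x % m ≡ y % m → x ≡ y
  %-injective (0<x , x≤m) (0<y , y≤m) eq with m≤n⇒m<n∨m≡n x≤m | m≤n⇒m<n∨m≡n y≤m
  ... | inj₁ x<m | inj₁ y<m = trans (sym (m<n⇒m%n≡m x<m)) (trans eq (m<n⇒m%n≡m y<m))
  ... | inj₁ x<m | inj₂ refl = contradiction (trans eq (n%n≡0 m)) (%≢0 0<x x<m)
  ... | inj₂ refl | inj₁ y<m = contradiction (trans (sym eq) (n%n≡0 m)) (%≢0 0<y y<m)
  ... | inj₂ refl | inj₂ refl = refl

  All-zip-≡ : All InRange xs → All InRange ys → length xs ≡ length ys →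
              All (λ p → proj₁ p ≡[mod m ] proj₂ p) (zip xs ys) → xs ≡ ys
  All-zip-≡ [] [] _ _ = refl
  All-zip-≡ (x∈ ∷ xs∈) (y∈ ∷ ys∈) len (x≡y ∷ xs≡ys) =
    cong₂ _∷_ (%-injective x∈ y∈ x≡y) (All-zip-≡ xs∈ ys∈ (suc-injective len) xs≡ys)

  palindromicMod⇒palindrome : ∀ cs → All (0 <_) cs → sum cs ≤ suc m →
                              PalindromicMod m cs → Palindrome cs
  palindromicMod⇒palindrome [] _ _ _ = refl
  palindromicMod⇒palindrome (x ∷ []) _ _ _ = refl
  palindromicMod⇒palindrome cs@(x ∷ y ∷ zs) positive sum≤ pal =
    All-zip-≡ inRange (All-resp-↭ (↭-sym (↭-reverse cs)) inRange) (sym (length-reverse cs)) pal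
    where
    inRange : All InRange cs
    inRange = All.zip (positive ,
      All.map (λ z< → ≤-pred (<-≤-trans z< sum≤)) (All-<-sum zs positive))

  palindrome⇒palindromicMod : ∀ cs → Palindrome cs → PalindromicMod m cs
  palindrome⇒palindromicMod cs pal =
    subst (λ ds → All (λ p → proj₁ p ≡[mod m ] proj₂ p) (zip cs ds)) pal (zipWith⁺ _,_ (Pointwise.refl refl))

  toComposition-palindromicMod⇔palindrome : ∀ b → length b ≤ m →
                                            PalindromicMod m (toComposition b) ⇔ Palindrome b
  toComposition-palindromicMod⇔palindrome b len≤m = mk⇔
    (Equivalence.from (palindrome⇔toComposition-palindrome b)
      ∘ palindromicMod⇒palindrome (toComposition b) (toComposition-positive b) sum≤)
    (palindrome⇒palindromicMod (toComposition b) ∘ Equivalence.to (palindrome⇔toComposition-palindrome b))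
    where
    sum≤ : sum (toComposition b) ≤ suc m
    sum≤ = subst (_≤ suc m) (sym (sum-toComposition b)) (s≤s len≤m)

  pc≡2^⌊n/2⌋ : ∀ n → n ≤ suc m → pc n m ≡ 2 ^ ⌊ n /2⌋
  pc≡2^⌊n/2⌋ zero _ = refl
  pc≡2^⌊n/2⌋ (suc n) (s≤s n≤m) = begin
    pc (suc n) m
      ≡⟨ cong (count (palindromicMod? m)) (compositions≡map-toComposition n) ⟩
    count (palindromicMod? m) (map toComposition (bitStrings n))
      ≡⟨ count-map (palindromicMod? m) toComposition (bitStrings n) ⟩
    count (palindromicMod? m ∘ toComposition) (bitStrings n)
      ≡⟨ count-cong _ palindrome? (All.map palindromicMod⇔palindrome (bitStrings-length n)) ⟩
    count palindrome? (bitStrings n)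
      ≡⟨ count-palindromes n ⟩
    2 ^ ⌈ n /2⌉ ∎
    where
    open ≡-Reasoning
    palindromicMod⇔palindrome : ∀ {b} → length b ≡ n → PalindromicMod m (toComposition b) ⇔ Palindrome b
    palindromicMod⇔palindrome {b} len≡n = toComposition-palindromicMod⇔palindrome b (subst (_≤ m) (sym len≡n) n≤m)

proposition3 : (m n : ℕ) → .{{_ : NonZero m}} → 1 ≤ n → 2 * n ≤ m →
    (pc (2 * n) m ≡ 2 ^ n) × (pc (2 * n + 1) m ≡ 2 ^ n)
proposition3 m n _ 2n≤m =
  trans (pc≡2^⌊n/2⌋ m (2 * n) (≤-trans 2n≤m (n≤1+n m))) (cong (2 ^_) ⌊2n/2⌋≡n) ,
  trans (pc≡2^⌊n/2⌋ m (2 * n + 1) (subst (_≤ suc m) (+-comm 1 (2 * n)) (s≤s 2n≤m))) (cong (2 ^_) ⌊2n+1/2⌋≡n)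
  where
  2n≡n+n : 2 * n ≡ n + n
  2n≡n+n = cong (n +_) (+-identityʳ n)
  ⌊2n/2⌋≡n : ⌊ 2 * n /2⌋ ≡ n
  ⌊2n/2⌋≡n = trans (cong ⌊_/2⌋ 2n≡n+n) (sym (n≡⌊n+n/2⌋ n))
  ⌊2n+1/2⌋≡n : ⌊ 2 * n + 1 /2⌋ ≡ n
  ⌊2n+1/2⌋≡n = trans (cong ⌊_/2⌋ (trans (+-comm (2 * n) 1) (cong suc 2n≡n+n))) (sym (n≡⌈n+n/2⌉ n))
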